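{- For every formula $\phi$ of the language $\mathcal{RD}$, $\phi$ is valid if and only if $\phi$ is provable in the axiom system $\mathbf{RD}$.
   Context: Fix a countable set $\textsc{prop}$ of propositional variables and a finite set $\textsc{ag}$ of agents; $\textsc{gr}=\wp(\textsc{ag})\setminus\{\emptyset\}$ is the set of groups. The language $\mathcal{RD}$ is given by $\phi ::= p \mid \neg\phi \mid \phi\wedge\phi \mid K_i\phi \mid D_G\phi \mid R_G\phi$ with $p\in\textsc{prop}$, $i\in\textsc{ag}$, $G\in\textsc{gr}$. A model is $\mathfrak{M}=(S,\sim,V)$ with $S$ a set of states, $\sim$ assigning to each agent $i$ an equivalence relation $\sim_i$ on $S$, and $V:\textsc{prop}\to 2^S$. For a group $G$, $\sim_G=\bigcap_{i\in G}\sim_i$. The $G$-resolved update of $\mathfrak{M}$ is $\mathfrak{M}|_G=(S,\sim|_G,V)$ where $(\sim|_G)_i=\sim_G$ if $i\in G$ and $(\sim|_G)_i=\sim_i$ otherwise. Satisfaction: $\mathfrak{M},s\models p$ iff $s\in V(p)$; Boolean clauses as usual; $\mathfrak{M},s\models K_i\phi$ iff $\mathfrak{M},t\models\phi$ for all $t$ with $s\sim_i t$; $\mathfrak{M},s\models D_G\phi$ iff $\mathfrak{M},t\models\phi$ for all $t$ with $s\sim_G t$; $\mathfrak{M},s\models R_G\phi$ iff $\mathfrak{M}|_G,s\models\phi$. A formula is valid if it is true at every state of every model. The system $\mathbf{RD}$ consists of: (PC) all instances of propositional tautologies; (K) $K_i(\phi\to\psi)\to(K_i\phi\to K_i\psi)$;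 (T) $K_i\phi\to\phi$; (4) $K_i\phi\to K_iK_i\phi$; (5) $\neg K_i\phi\to K_i\neg K_i\phi$; (MP) from $\phi$ and $\phi\to\psi$ infer $\psi$; (N) from $\phi$ infer $K_i\phi$; (K$_D$) $D_G(\phi\to\psi)\to(D_G\phi\to D_G\psi)$; (T$_D$) $D_G\phi\to\phi$; (5$_D$) $\neg D_G\phi\to D_G\neg D_G\phi$; (D1) $K_i\phi\leftrightarrow D_{\{i\}}\phi$; (D2) $D_G\phi\to D_H\phi$ if $G\subseteq H$; (RA) $R_Gp\leftrightarrow p$; (RC) $R_G(\phi\wedge\psi)\leftrightarrow R_G\phi\wedge R_G\psi$; (RN) $R_G\neg\phi\leftrightarrow\neg R_G\phi$; (RD1) $R_GD_H\phi\leftrightarrow D_{G\cup H}R_G\phi$ if $G\cap H\neq\emptyset$; (RD2) $R_GD_H\phi\leftrightarrow D_HR_G\phi$ if $G\cap H=\emptyset$; (N$_R$) from $\phi$ infer $R_G\phi$. -}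

module Defs where

open import Data.Nat using (ℕ)
open import Data.Fin using (Fin)
open import Data.Fin.Subset using (Subset; _∈_; _⊆_; _∪_; _∩_; Nonempty; Empty)
open import Data.Bool using (Bool; true; false; not; _∧_)
open import Data.Product using (_×_; Σ; ∃; _,_)
open import Data.Fin.Subset using (⁅_⁆)
open import Data.Fin.Subset.Properties using (p⊆p∪q; x∈⁅x⁆)
open import Data.Vec using (lookup)
open import Relation.Binary.Definitions using (Reflexive; Symmetric; Transitive)
open import Relation.Binary.Structures using (IsEquivalence)
open import Relation.Binary.PropositionalEquality using (_≡_)
open import Relation.Nullary using (¬_)

Prop : Set
Prop = ℕ

record Grp (n : ℕ) : Set where
  constructor grp
  field
    set      : Subset n
    nonempty : Nonempty set
open Grp public

_∪G_ : ∀ {n} → Grp n → Grp n → Grp n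
grp G (i , i∈G) ∪G grp H _ = grp (G ∪ H) (i , p⊆p∪q H i∈G)

single : ∀ {n} → Fin n → Grp n
single i = grp ⁅ i ⁆ (i , x∈⁅x⁆ i)

data Fm (n : ℕ) : Set where
  var  : Prop → Fm n
  ¬'_  : Fm n → Fm n
  _∧'_ : Fm n → Fm n → Fm n
  K    : Fin n → Fm n → Fm n
  D    : Grp n → Fm n → Fm n
  R    : Grp n → Fm n → Fm n

infixr 6 _∧'_
infixr 5 _→'_ _↔'_

_→'_ : ∀ {n} → Fm n → Fm n → Fm n
φ →' ψ = ¬' (φ ∧' ¬' ψ)

_↔'_ : ∀ {n} → Fm n → Fm n → Fm n
φ ↔' ψ = (φ →' ψ) ∧' (ψ →' φ)

Rels : ℕ → Set → Set₁
Rels n S = Fin n → S → S → Set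

∼G : ∀ {n S} → Rels n S → Grp n → S → S → Set
∼G ∼ G s t = ∀ i → i ∈ set G → ∼ i s t

record Model (n : ℕ) : Set₁ where
  field
    S     : Set
    ∼     : Rels n S
    equiv : ∀ i → IsEquivalence (∼ i)
    V     : Prop → S → Set

update : ∀ {n S} → Rels n S → Grp n → Rels n S
update ∼ G i s t with lookup (set G) i
... | true  = ∼G ∼ G s t
... | false = ∼ i s t

-- Satisfaction (the valuation V is unchanged by updates, so it is carried
-- separately; the relation family changes under R_G).
sat : ∀ {n S} → Rels n S → (Prop → S → Set) → S → Fm n → Set
sat ∼ V s (var p)   = V p s
sat ∼ V s (¬' φ)    = ¬ sat ∼ V s φ
sat ∼ V s (φ ∧' ψ)  = sat ∼ V s φ × sat ∼ V s ψ
sat ∼ V s (K i φ)   = ∀ t → ∼ i s t → sat ∼ V t φ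
sat ∼ V s (D G φ)   = ∀ t → ∼G ∼ G s t → sat ∼ V t φ
sat ∼ V s (R G φ)   = sat (update ∼ G) V s φ

_,_⊨_ : ∀ {n} (M : Model n) → Model.S M → Fm n → Set
M , s ⊨ φ = sat (Model.∼ M) (Model.V M) s φ

Valid : ∀ {n} → Fm n → Set₁
Valid {n} φ = (M : Model n) (s : Model.S M) → M , s ⊨ φ

-- Propositional tautology: true under every Boolean valuation that treats
-- all non-Boolean (atomic or modal) subformulas as atoms.
evalB : ∀ {n} → (Fm n → Bool) → Fm n → Bool
evalB v (¬' φ)   = not (evalB v φ)
evalB v (φ ∧' ψ) = evalB v φ ∧ evalB v ψ
evalB v φ        = v φ

Tautology : ∀ {n} → Fm n → Set
Tautology φ = ∀ v → evalB v φ ≡ true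

data ⊢_ {n : ℕ} : Fm n → Set where
  PC  : ∀ {φ} → Tautology φ → ⊢ φ
  Kax : ∀ {i φ ψ} → ⊢ (K i (φ →' ψ) →' (K i φ →' K i ψ))
  Tax : ∀ {i φ} → ⊢ (K i φ →' φ)
  4ax : ∀ {i φ} → ⊢ (K i φ →' K i (K i φ))
  5ax : ∀ {i φ} → ⊢ (¬' K i φ →' K i (¬' K i φ))
  MP  : ∀ {φ ψ} → ⊢ φ → ⊢ (φ →' ψ) → ⊢ ψ
  Nec : ∀ {i φ} → ⊢ φ → ⊢ K i φ
  KD  : ∀ {G φ ψ} → ⊢ (D G (φ →' ψ) →' (D G φ →' D G ψ))
  TD  : ∀ {G φ} → ⊢ (D G φ →' φ)
  5D  : ∀ {G φ} → ⊢ (¬' D G φ →' D G (¬' D G φ))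
  D1  : ∀ {i φ} → ⊢ (K i φ ↔' D (single i) φ)
  D2  : ∀ {G H φ} → set G ⊆ set H → ⊢ (D G φ →' D H φ)
  RA  : ∀ {G p} → ⊢ (R G (var p) ↔' var p)
  RC  : ∀ {G φ ψ} → ⊢ (R G (φ ∧' ψ) ↔' (R G φ ∧' R G ψ))
  RN  : ∀ {G φ} → ⊢ (R G (¬' φ) ↔' ¬' R G φ)
  RD1 : ∀ {G H φ} → Nonempty (set G ∩ set H) →
        ⊢ (R G (D H φ) ↔' D (G ∪G H) (R G φ))
  RD2 : ∀ {G H φ} → Empty (set G ∩ set H) →
        ⊢ (R G (D H φ) ↔' D H (R G φ))
  NR  : ∀ {G φ} → ⊢ φ → ⊢ R G φ

-- Soundness is checked axiom by axiom; the resolution axioms RD1/RD2 hold because in the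
-- G-resolved model the relation for a group H is ∼_{G∪H} when G and H meet and ∼_H otherwise.
--
-- For completeness, the reduction axioms rewrite every formula, provably equivalently, into
-- one built from atoms, ¬, ∧ and D_G only (K_i becoming D_{i}).  For that language we build
-- a canonical model whose worlds are atoms (consistent formulas deciding every subformula)
-- arranged in a tree: an edge labelled g joins atoms agreeing on all D_H-subformulas with
-- H ⊆ g, and s ∼_i t when the tree path from s to t only crosses edges whose labels contain
-- i.  Since the path is unique, s ∼_G t says that every label on it contains G, which is what
-- the truth lemma needs for D_G.  Excluded middle gives the classical reading of → and
-- decides consistency in the Lindenbaum construction.

module Submission where

open import Defs
open import Axiom.ExcludedMiddle using (ExcludedMiddle)
open import Data.Bool using (Bool; true; false; not; _∧_; T)
open import Data.Bool.Properties using (T-≡; T-∧)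
open import Data.Empty using (⊥; ⊥-elim)
open import Data.Fin using (Fin; zero; suc)
open import Data.Fin.Subset using (Subset; _∩_; Nonempty; Empty)
  renaming (_∈_ to _∈ˢ_; _∉_ to _∉ˢ_; _⊆_ to _⊆ˢ_)
open import Data.Fin.Subset.Properties
  using (_∈?_; nonempty?; p⊆p∪q; q⊆p∪q; x∈p∪q⁻; x∈p∩q⁺; x∈p∩q⁻; x∈⁅x⁆; x∈⁅y⁆⇒x≡y)
open import Data.List using (List; []; _∷_; _++_)
open import Data.List.Membership.Propositional using (_∈_)
open import Data.List.Membership.Propositional.Properties using (∈-++⁺ˡ; ∈-++⁺ʳ)
open import Data.List.Relation.Unary.All using (All; []; _∷_)
import Data.List.Relation.Unary.All as All
open import Data.List.Relation.Unary.Any using (here; there)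
open import Data.Nat using (ℕ; zero; suc)
open import Data.Product using (_×_; Σ; ∃-syntax; _,_; proj₁; proj₂)
open import Data.Product.Function.NonDependent.Propositional using (_×-⇔_)
open import Data.Sum using (_⊎_; inj₁; inj₂)
import Data.Sum as Sum
open import Data.Unit using (⊤; tt)
open import Data.Vec using (Vec; []; _∷_; lookup; map)
open import Data.Vec.Properties using (lookup-map; []=⇒lookup; lookup⇒[]=)
open import Function using (_∘_; id)
open import Function.Bundles using (_⇔_; mk⇔; Equivalence)
open import Function.Construct.Composition using (_⇔-∘_)
open import Function.Construct.Identity using (⇔-id)
open import Function.Construct.Symmetry using (⇔-sym)
open import Function.Related.TypeIsomorphisms using (¬-cong-⇔)
import Level
open import Relation.Binary.PropositionalEquality using (_≡_; refl; sym; trans; cong; cong₂; subst)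
open import Relation.Binary.Structures using (IsEquivalence)
open import Relation.Nullary using (¬_; Dec; yes; no; does)
open import Relation.Nullary.Decidable using (decidable-stable)

open Equivalence using (to; from)

private
  variable
    n : ℕ
    a b c d : Fm n
    G : Grp n

data PForm (k : ℕ) : Set where
  atom : Fin k → PForm k
  neg  : PForm k → PForm k
  conj : PForm k → PForm k → PForm k

infixr 5 _⇒_
_⇒_ : ∀ {k} → PForm k → PForm k → PForm k
p ⇒ q = neg (conj p (neg q))

x₀ : ∀ {k} → PForm (suc k)
x₀ = atom zero
x₁ : ∀ {k} → PForm (suc (suc k))
x₁ = atom (suc zero)
x₂ : ∀ {k} → PForm (suc (suc (suc k)))
x₂ = atom (suc (suc zero))
x₃ : ∀ {k} → PForm (suc (suc (suc (suc k))))
x₃ = atom (suc (suc (suc zero)))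

evalP : ∀ {k} → Vec Bool k → PForm k → Bool
evalP ρ (atom i)   = lookup ρ i
evalP ρ (neg p)    = not (evalP ρ p)
evalP ρ (conj p q) = evalP ρ p ∧ evalP ρ q

everyValuation : ∀ k → (Vec Bool k → Bool) → Bool
everyValuation zero    f = f []
everyValuation (suc k) f = everyValuation k (f ∘ (true ∷_)) ∧ everyValuation k (f ∘ (false ∷_))

everyValuation-sound : ∀ k f → T (everyValuation k f) → ∀ ρ → T (f ρ)
everyValuation-sound zero    f t []          = t
everyValuation-sound (suc k) f t (true ∷ ρ)  = everyValuation-sound k _ (proj₁ (to T-∧ t)) ρ
everyValuation-sound (suc k) f t (false ∷ ρ) = everyValuation-sound k _ (proj₂ (to T-∧ t)) ρ

infix 25 _[_]
_[_] : ∀ {k} → PForm k → Vec (Fm n) k → Fm n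
atom i   [ σ ] = lookup σ i
neg p    [ σ ] = ¬' (p [ σ ])
conj p q [ σ ] = p [ σ ] ∧' q [ σ ]

evalB-[] : ∀ {k} v (P : PForm k) (σ : Vec (Fm n) k) → evalB v (P [ σ ]) ≡ evalP (map (evalB v) σ) P
evalB-[] v (atom i)   σ = sym (lookup-map i (evalB v) σ)
evalB-[] v (neg p)    σ = cong not (evalB-[] v p σ)
evalB-[] v (conj p q) σ = cong₂ _∧_ (evalB-[] v p σ) (evalB-[] v q σ)

-- The instance argument normalises to ⊤ exactly when P is a tautology.
tautology : ∀ {k} (P : PForm k) (σ : Vec (Fm n) k) →
            {{T (everyValuation k (λ ρ → evalP ρ P))}} → ⊢ P [ σ ]
tautology {k = k} P σ {{t}} = PC λ v →
  trans (evalB-[] v P σ) (to T-≡ (everyValuation-sound k (λ ρ → evalP ρ P) t (map (evalB v) σ)))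

→'-refl : ⊢ (a →' a)
→'-refl {a = a} = tautology (x₀ ⇒ x₀) (a ∷ [])

→'-trans : ⊢ (a →' b) → ⊢ (b →' c) → ⊢ (a →' c)
→'-trans {a = a} {b = b} {c = c} p q =
  MP q (MP p (tautology ((x₀ ⇒ x₁) ⇒ (x₁ ⇒ x₂) ⇒ (x₀ ⇒ x₂)) (a ∷ b ∷ c ∷ [])))

∧'-intro : ⊢ a → ⊢ b → ⊢ (a ∧' b)
∧'-intro {a = a} {b = b} p q = MP q (MP p (tautology (x₀ ⇒ x₁ ⇒ conj x₀ x₁) (a ∷ b ∷ [])))

∧'-elimˡ : ⊢ (a ∧' b →' a)
∧'-elimˡ {a = a} {b = b} = tautology (conj x₀ x₁ ⇒ x₀) (a ∷ b ∷ [])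

∧'-elimʳ : ⊢ (a ∧' b →' b)
∧'-elimʳ {a = a} {b = b} = tautology (conj x₀ x₁ ⇒ x₁) (a ∷ b ∷ [])

→'-∧' : ⊢ (a →' b) → ⊢ (a →' c) → ⊢ (a →' b ∧' c)
→'-∧' {a = a} {b = b} {c = c} p q =
  MP q (MP p (tautology ((x₀ ⇒ x₁) ⇒ (x₀ ⇒ x₂) ⇒ (x₀ ⇒ conj x₁ x₂)) (a ∷ b ∷ c ∷ [])))

∧'-mono : ⊢ (a →' b) → ⊢ (c →' d) → ⊢ (a ∧' c →' b ∧' d)
∧'-mono p q = →'-∧' (→'-trans ∧'-elimˡ p) (→'-trans ∧'-elimʳ q)

contraposition : ⊢ (a →' b) → ⊢ (¬' b →' ¬' a)
contraposition {a = a} {b = b} p = MP p (tautology ((x₀ ⇒ x₁) ⇒ (neg x₁ ⇒ neg x₀)) (a ∷ b ∷ []))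

contraposition-¬ˡ : ⊢ (¬' a →' b) → ⊢ (¬' b →' a)
contraposition-¬ˡ {a = a} {b = b} p = MP p (tautology ((neg x₀ ⇒ x₁) ⇒ (neg x₁ ⇒ x₀)) (a ∷ b ∷ []))

contraposition-¬ʳ : ⊢ (a →' ¬' b) → ⊢ (b →' ¬' a)
contraposition-¬ʳ {a = a} {b = b} p = MP p (tautology ((x₀ ⇒ neg x₁) ⇒ (x₁ ⇒ neg x₀)) (a ∷ b ∷ []))

¬'¬'-elim : ⊢ (¬' ¬' a) → ⊢ a
¬'¬'-elim {a = a} p = MP p (tautology (neg (neg x₀) ⇒ x₀) (a ∷ []))

→'-weaken : ⊢ b → ⊢ (a →' b)
→'-weaken {b = b} {a = a} p = MP p (tautology (x₀ ⇒ x₁ ⇒ x₀) (b ∷ a ∷ []))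

refute : ⊢ (a →' b) → ⊢ (a →' ¬' b) → ⊢ (¬' a)
refute {a = a} {b = b} p q =
  MP q (MP p (tautology ((x₀ ⇒ x₁) ⇒ (x₀ ⇒ neg x₁) ⇒ neg x₀) (a ∷ b ∷ [])))

refute-cases : ⊢ (¬' (a ∧' b)) → ⊢ (¬' (a ∧' ¬' b)) → ⊢ (¬' a)
refute-cases {a = a} {b = b} p q =
  MP q (MP p (tautology (neg (conj x₀ x₁) ⇒ neg (conj x₀ (neg x₁)) ⇒ neg x₀) (a ∷ b ∷ [])))

↔'-to : ⊢ (a ↔' b) → ⊢ (a →' b)
↔'-to p = MP p ∧'-elimˡ

↔'-from : ⊢ (a ↔' b) → ⊢ (b →' a)
↔'-from p = MP p ∧'-elimʳ

↔'-¬' : ⊢ (a ↔' b) → ⊢ (¬' a ↔' ¬' b)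
↔'-¬' p = ∧'-intro (contraposition (↔'-from p)) (contraposition (↔'-to p))

↔'-∧' : ⊢ (a ↔' b) → ⊢ (c ↔' d) → ⊢ (a ∧' c ↔' b ∧' d)
↔'-∧' p q = ∧'-intro (∧'-mono (↔'-to p) (↔'-to q)) (∧'-mono (↔'-from p) (↔'-from q))

↔'-refl : ⊢ (a ↔' a)
↔'-refl = ∧'-intro →'-refl →'-refl

↔'-trans : ⊢ (a ↔' b) → ⊢ (b ↔' c) → ⊢ (a ↔' c)
↔'-trans p q = ∧'-intro (→'-trans (↔'-to p) (↔'-to q)) (→'-trans (↔'-from q) (↔'-from p))

D-nec : ⊢ a → ⊢ D G a
D-nec {G = grp g (i , i∈g)} p =
  MP (MP (Nec p) (↔'-to D1)) (D2 λ j∈⁅i⁆ → subst (_∈ˢ g) (sym (x∈⁅y⁆⇒x≡y i j∈⁅i⁆)) i∈g)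

D-mono : ⊢ (a →' b) → ⊢ (D G a →' D G b)
D-mono p = MP (D-nec p) KD

D-cong : ⊢ (a ↔' b) → ⊢ (D G a ↔' D G b)
D-cong p = ∧'-intro (D-mono (↔'-to p)) (D-mono (↔'-from p))

D-∧' : ⊢ (D G a ∧' D G b →' D G (a ∧' b))
D-∧' {G = G} {a = a} {b = b} = MP KD (MP (D-mono (tautology (x₀ ⇒ x₁ ⇒ conj x₀ x₁) (a ∷ b ∷ [])))
  (tautology ((x₀ ⇒ x₁) ⇒ (x₁ ⇒ x₂ ⇒ x₃) ⇒ (conj x₀ x₂ ⇒ x₃))
             (D G a ∷ D G (b →' a ∧' b) ∷ D G b ∷ D G (a ∧' b) ∷ [])))

D-4 : ⊢ (D G a →' D G (D G a))
D-4 = →'-trans (contraposition-¬ʳ TD) (→'-trans 5D (D-mono (contraposition-¬ˡ 5D)))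

R-→' : ⊢ (R G (a →' b) ↔' (R G a →' R G b))
R-→' = ↔'-trans RN (↔'-¬' (↔'-trans RC (↔'-∧' ↔'-refl RN)))

R-mono : ⊢ (a →' b) → ⊢ (R G a →' R G b)
R-mono p = MP (NR p) (↔'-to R-→')

R-cong : ⊢ (a ↔' b) → ⊢ (R G a ↔' R G b)
R-cong p = ∧'-intro (R-mono (↔'-to p)) (R-mono (↔'-from p))

module _ {S : Set} (∼ : Rels n S) (equiv : ∀ i → IsEquivalence (∼ i)) where

  ∼G-isEquivalence : ∀ G → IsEquivalence (∼G ∼ G)
  ∼G-isEquivalence G = record
    { refl  = λ i _ → IsEquivalence.refl (equiv i)
    ; sym   = λ r i i∈G → IsEquivalence.sym (equiv i) (r i i∈G)
    ; trans = λ r r′ i i∈G → IsEquivalence.trans (equiv i) (r i i∈G) (r′ i i∈G)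
    }

module _ {S : Set} (∼ : Rels n S) {s t : S} where

  update-∈ : ∀ G {i} → i ∈ˢ set G → update ∼ G i s t ⇔ ∼G ∼ G s t
  update-∈ G {i} i∈G with lookup (set G) i | []=⇒lookup i∈G
  ... | true | _ = ⇔-id _

  update-∉ : ∀ G {i} → i ∉ˢ set G → update ∼ G i s t ⇔ ∼ i s t
  update-∉ G {i} i∉G with lookup (set G) i in eq
  ... | true  = ⊥-elim (i∉G (lookup⇒[]= i (set G) eq))
  ... | false = ⇔-id _

  ∼G-single : ∀ i → ∼G ∼ (single i) s t ⇔ ∼ i s t
  ∼G-single i = mk⇔
    (λ r → r i (x∈⁅x⁆ i))
    (λ r j j∈⁅i⁆ → subst (λ j → ∼ j s t) (sym (x∈⁅y⁆⇒x≡y i j∈⁅i⁆)) r)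

  ∼G-antitone : ∀ G H → set G ⊆ˢ set H → ∼G ∼ H s t → ∼G ∼ G s t
  ∼G-antitone G H G⊆H r i i∈G = r i (G⊆H i∈G)

  ∼G-update-overlapping : ∀ G H → Nonempty (set G ∩ set H) →
                          ∼G (update ∼ G) H s t ⇔ ∼G ∼ (G ∪G H) s t
  ∼G-update-overlapping G H (k , k∈G∩H) = mk⇔ forth back
    where
      k∈G = proj₁ (x∈p∩q⁻ (set G) (set H) k∈G∩H)
      k∈H = proj₂ (x∈p∩q⁻ (set G) (set H) k∈G∩H)
      forth : ∼G (update ∼ G) H s t → ∼G ∼ (G ∪G H) s t
      forth r j j∈G∪H with j ∈? set G | x∈p∪q⁻ (set G) (set H) j∈G∪H
      ... | yes j∈G | _        = to (update-∈ G k∈G) (r k k∈H) j j∈G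
      ... | no j∉G  | inj₁ j∈G = ⊥-elim (j∉G j∈G)
      ... | no j∉G  | inj₂ j∈H = to (update-∉ G j∉G) (r j j∈H)
      back : ∼G ∼ (G ∪G H) s t → ∼G (update ∼ G) H s t
      back r i i∈H with i ∈? set G
      ... | yes i∈G = from (update-∈ G i∈G) (λ j j∈G → r j (p⊆p∪q (set H) j∈G))
      ... | no i∉G  = from (update-∉ G i∉G) (r i (q⊆p∪q (set G) (set H) i∈H))

  ∼G-update-disjoint : ∀ G H → Empty (set G ∩ set H) → ∼G (update ∼ G) H s t ⇔ ∼G ∼ H s t
  ∼G-update-disjoint G H G∩H≡∅ = mk⇔
    (λ r i i∈H → to (update-∉ G (i∉G i∈H)) (r i i∈H))
    (λ r i i∈H → from (update-∉ G (i∉G i∈H)) (r i i∈H))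
    where
      i∉G : ∀ {i} → i ∈ˢ set H → i ∉ˢ set G
      i∉G i∈H i∈G = G∩H≡∅ (_ , x∈p∩q⁺ (i∈G , i∈H))

isEquivalence-⇔ : ∀ {S : Set} {R R′ : S → S → Set} →
                  (∀ {s t} → R s t ⇔ R′ s t) → IsEquivalence R′ → IsEquivalence R
isEquivalence-⇔ R⇔R′ e = record
  { refl  = from R⇔R′ (IsEquivalence.refl e)
  ; sym   = λ r → from R⇔R′ (IsEquivalence.sym e (to R⇔R′ r))
  ; trans = λ r r′ → from R⇔R′ (IsEquivalence.trans e (to R⇔R′ r) (to R⇔R′ r′))
  }

update-isEquivalence : ∀ {S : Set} (∼ : Rels n S) → (∀ i → IsEquivalence (∼ i)) →
                       ∀ G i → IsEquivalence (update ∼ G i)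
update-isEquivalence ∼ equiv G i with i ∈? set G
... | yes i∈G = isEquivalence-⇔ (update-∈ ∼ G i∈G) (∼G-isEquivalence ∼ equiv G)
... | no i∉G  = isEquivalence-⇔ (update-∉ ∼ G i∉G) (equiv i)

-- Soundness

T-not : ∀ b → T (not b) ⇔ (¬ T b)
T-not true  = mk⇔ (λ ()) (λ ¬t → ¬t _)
T-not false = mk⇔ (λ _ ()) _

T-does : ∀ {P : Set} (P? : Dec P) → T (does P?) ⇔ P
T-does (yes p) = mk⇔ (λ _ → p) _
T-does (no ¬p) = mk⇔ (λ ()) ¬p

⇒⁺ : ∀ {P Q : Set} → (P → Q) → ¬ (P × ¬ Q)
⇒⁺ f (p , ¬q) = ¬q (f p)

⇔⁺ : ∀ {P Q : Set} → P ⇔ Q → ¬ (P × ¬ Q) × ¬ (Q × ¬ P)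
⇔⁺ P⇔Q = ⇒⁺ (to P⇔Q) , ⇒⁺ (from P⇔Q)

∀-restrict-cong : ∀ {S : Set} {A B P : S → Set} →
                  (∀ {t} → A t ⇔ B t) → (∀ t → A t → P t) ⇔ (∀ t → B t → P t)
∀-restrict-cong A⇔B = mk⇔ (λ f t b → f t (from A⇔B b)) (λ g t a → g t (to A⇔B a))

module _ {S : Set} {_≈_ : S → S → Set} (e : IsEquivalence _≈_) {P : S → Set} {s : S} where
  private module E = IsEquivalence e

  □-T : (∀ t → s ≈ t → P t) → P s
  □-T □P = □P s E.refl

  □-4 : (∀ t → s ≈ t → P t) → ∀ t → s ≈ t → ∀ u → t ≈ u → P u
  □-4 □P t s≈t u t≈u = □P u (E.trans s≈t t≈u)

  □-5 : ¬ (∀ t → s ≈ t → P t) → ∀ t → s ≈ t → ¬ (∀ u → t ≈ u → P u)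
  □-5 ¬□P t s≈t □Pt = ¬□P λ u s≈u → □Pt u (E.trans (E.sym s≈t) s≈u)

module Soundness (em : ExcludedMiddle Level.zero) where

  ⇒⁻ : ∀ {P Q : Set} → ¬ (P × ¬ Q) → P → Q
  ⇒⁻ h p = decidable-stable em λ ¬q → h (p , ¬q)

  module _ {S : Set} (∼ : Rels n S) (V : Prop → S → Set) (s : S) where

    truthValue : Fm n → Bool
    truthValue χ = does (em {sat ∼ V s χ})

    T-evalB-truthValue : ∀ χ → T (evalB truthValue χ) ⇔ sat ∼ V s χ
    T-evalB-truthValue (¬' χ)   = ¬-cong-⇔ (T-evalB-truthValue χ) ⇔-∘ T-not _
    T-evalB-truthValue (χ ∧' ψ) = (T-evalB-truthValue χ ×-⇔ T-evalB-truthValue ψ) ⇔-∘ T-∧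
    T-evalB-truthValue (var _)  = T-does em
    T-evalB-truthValue (K _ _)  = T-does em
    T-evalB-truthValue (D _ _)  = T-does em
    T-evalB-truthValue (R _ _)  = T-does em

  sound : ∀ {φ : Fm n} → ⊢ φ →
          ∀ {S} (∼ : Rels n S) → (∀ i → IsEquivalence (∼ i)) → ∀ V s → sat ∼ V s φ
  sound {φ = φ} (PC taut) ∼ equiv V s = to (T-evalB-truthValue ∼ V s φ) (from T-≡ (taut _))
  sound Kax ∼ equiv V s = ⇒⁺ λ □φ→ψ → ⇒⁺ λ □φ t r → ⇒⁻ (□φ→ψ t r) (□φ t r)
  sound (Tax {i}) ∼ equiv V s = ⇒⁺ (□-T (equiv i))
  sound (4ax {i}) ∼ equiv V s = ⇒⁺ (□-4 (equiv i))
  sound (5ax {i}) ∼ equiv V s = ⇒⁺ (□-5 (equiv i))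
  sound (MP p q) ∼ equiv V s = ⇒⁻ (sound q ∼ equiv V s) (sound p ∼ equiv V s)
  sound (Nec p) ∼ equiv V s = λ t _ → sound p ∼ equiv V t
  sound KD ∼ equiv V s = ⇒⁺ λ □φ→ψ → ⇒⁺ λ □φ t r → ⇒⁻ (□φ→ψ t r) (□φ t r)
  sound (TD {G}) ∼ equiv V s = ⇒⁺ (□-T (∼G-isEquivalence ∼ equiv G))
  sound (5D {G}) ∼ equiv V s = ⇒⁺ (□-5 (∼G-isEquivalence ∼ equiv G))
  sound D1 ∼ equiv V s = ⇔⁺ (∀-restrict-cong (⇔-sym (∼G-single ∼ _)))
  sound (D2 {G} {H} G⊆H) ∼ equiv V s = ⇒⁺ λ □φ t r → □φ t (∼G-antitone ∼ G H G⊆H r)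
  sound RA ∼ equiv V s = ⇔⁺ (⇔-id _)
  sound RC ∼ equiv V s = ⇔⁺ (⇔-id _)
  sound RN ∼ equiv V s = ⇔⁺ (⇔-id _)
  sound (RD1 {G} {H} G∩H≢∅) ∼ equiv V s = ⇔⁺ (∀-restrict-cong (∼G-update-overlapping ∼ G H G∩H≢∅))
  sound (RD2 {G} {H} G∩H≡∅) ∼ equiv V s = ⇔⁺ (∀-restrict-cong (∼G-update-disjoint ∼ G H G∩H≡∅))
  sound (NR {G} p) ∼ equiv V s = sound p (update ∼ G) (update-isEquivalence ∼ equiv G) V s

  soundness : ∀ {φ : Fm n} → ⊢ φ → Valid φ
  soundness p M = sound p (Model.∼ M) (Model.equiv M) (Model.V M)

  valid-→' : ∀ {φ ψ : Fm n} → ⊢ (φ →' ψ) → Valid φ → Valid ψ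
  valid-→' p ⊨φ M s = ⇒⁻ (soundness p M s) (⊨φ M s)

-- Reduction to the language of distributed knowledge

data DForm {n : ℕ} : Fm n → Set where
  var  : ∀ {p} → DForm (var p)
  ¬'_  : ∀ {φ} → DForm φ → DForm (¬' φ)
  _∧'_ : ∀ {φ ψ} → DForm φ → DForm ψ → DForm (φ ∧' ψ)
  D    : ∀ {G φ} → DForm φ → DForm (D G φ)

-- Outside DForm, R G is left in place.
reduceR : Grp n → Fm n → Fm n
reduceR G (var p)  = var p
reduceR G (¬' φ)   = ¬' reduceR G φ
reduceR G (φ ∧' ψ) = reduceR G φ ∧' reduceR G ψ
reduceR G (D H φ) with nonempty? (set G ∩ set H)
... | yes _ = D (G ∪G H) (reduceR G φ)
... | no _  = D H (reduceR G φ)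
reduceR G φ        = R G φ

reduceR-DForm : ∀ G {φ : Fm n} → DForm φ → DForm (reduceR G φ)
reduceR-DForm G var        = var
reduceR-DForm G (¬' d)     = ¬' reduceR-DForm G d
reduceR-DForm G (d ∧' d′)  = reduceR-DForm G d ∧' reduceR-DForm G d′
reduceR-DForm G (D {H} d) with nonempty? (set G ∩ set H)
... | yes _ = D (reduceR-DForm G d)
... | no _  = D (reduceR-DForm G d)

reduceR-equiv : ∀ G {φ : Fm n} → DForm φ → ⊢ (R G φ ↔' reduceR G φ)
reduceR-equiv G var        = RA
reduceR-equiv G (¬' d)     = ↔'-trans RN (↔'-¬' (reduceR-equiv G d))
reduceR-equiv G (d ∧' d′)  = ↔'-trans RC (↔'-∧' (reduceR-equiv G d) (reduceR-equiv G d′))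
reduceR-equiv G (D {H} d) with nonempty? (set G ∩ set H)
... | yes G∩H≢∅ = ↔'-trans (RD1 G∩H≢∅) (D-cong (reduceR-equiv G d))
... | no G∩H≡∅  = ↔'-trans (RD2 G∩H≡∅) (D-cong (reduceR-equiv G d))

reduce : Fm n → Fm n
reduce (var p)  = var p
reduce (¬' φ)   = ¬' reduce φ
reduce (φ ∧' ψ) = reduce φ ∧' reduce ψ
reduce (K i φ)  = D (single i) (reduce φ)
reduce (D G φ)  = D G (reduce φ)
reduce (R G φ)  = reduceR G (reduce φ)

reduce-DForm : ∀ (φ : Fm n) → DForm (reduce φ)
reduce-DForm (var p)  = var
reduce-DForm (¬' φ)   = ¬' reduce-DForm φ
reduce-DForm (φ ∧' ψ) = reduce-DForm φ ∧' reduce-DForm ψ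
reduce-DForm (K i φ)  = D (reduce-DForm φ)
reduce-DForm (D G φ)  = D (reduce-DForm φ)
reduce-DForm (R G φ)  = reduceR-DForm G (reduce-DForm φ)

reduce-equiv : ∀ (φ : Fm n) → ⊢ (φ ↔' reduce φ)
reduce-equiv (var p)  = ↔'-refl
reduce-equiv (¬' φ)   = ↔'-¬' (reduce-equiv φ)
reduce-equiv (φ ∧' ψ) = ↔'-∧' (reduce-equiv φ) (reduce-equiv ψ)
reduce-equiv (K i φ)  = ↔'-trans D1 (D-cong (reduce-equiv φ))
reduce-equiv (D G φ)  = D-cong (reduce-equiv φ)
reduce-equiv (R G φ)  = ↔'-trans (R-cong (reduce-equiv φ)) (reduceR-equiv G (reduce-DForm φ))

data Linked {A : Set} (P : A → Set) : List A → List A → Set where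
  diverge : ∀ {xs ys} → All P xs → All P ys → Linked P xs ys
  common  : ∀ {x xs ys} → Linked P xs ys → Linked P (x ∷ xs) (x ∷ ys)

module _ {A : Set} {P : A → Set} where

  linked-refl : ∀ xs → Linked P xs xs
  linked-refl []       = diverge [] []
  linked-refl (x ∷ xs) = common (linked-refl xs)

  linked-sym : ∀ {xs ys} → Linked P xs ys → Linked P ys xs
  linked-sym (diverge pxs pys) = diverge pys pxs
  linked-sym (common r)        = common (linked-sym r)

  linked-all : ∀ {xs ys} → Linked P xs ys → All P xs → All P ys
  linked-all (diverge _ pys) _          = pys
  linked-all (common r)      (px ∷ pxs) = px ∷ linked-all r pxs

  linked-trans : ∀ {xs ys zs} → Linked P xs ys → Linked P ys zs → Linked P xs zs
  linked-trans (diverge pxs _)          (diverge _ pzs)          = diverge pxs pzs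
  linked-trans (diverge pxs (py ∷ pys)) (common r)               = diverge pxs (py ∷ linked-all r pys)
  linked-trans (common r)               (diverge (px ∷ pxs) pzs) =
    diverge (px ∷ linked-all (linked-sym r) pxs) pzs
  linked-trans (common r)               (common r′)              = common (linked-trans r r′)

  linked-snoc : ∀ {y} → P y → ∀ xs → Linked P xs (xs ++ y ∷ [])
  linked-snoc py []       = diverge [] (py ∷ [])
  linked-snoc py (x ∷ xs) = common (linked-snoc py xs)

  linked-map : ∀ {Q : A → Set} {xs ys} → (∀ {x} → P x → Q x) → Linked P xs ys → Linked Q xs ys
  linked-map f (diverge pxs pys) = diverge (All.map f pxs) (All.map f pys)
  linked-map f (common r)        = common (linked-map f r)

module _ {A : Set} {I : Set} {P : I → A → Set} where

  private
    All-⋂ : ∀ {xs} → (∀ i → All (P i) xs) → All (λ x → ∀ i → P i x) xs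
    All-⋂ h = All.tabulate λ x∈xs i → All.lookup (h i) x∈xs

    linked-[]ˡ : ∀ {Q : A → Set} {ys} → Linked Q [] ys → All Q ys
    linked-[]ˡ (diverge _ qys) = qys

    linked-∷⁻ : ∀ {Q : A → Set} {x xs ys} → Linked Q (x ∷ xs) (x ∷ ys) → Linked Q xs ys
    linked-∷⁻ (diverge (_ ∷ qxs) (_ ∷ qys)) = diverge qxs qys
    linked-∷⁻ (common r)                    = r

    linked-≢ : ∀ {Q : A → Set} {x y xs ys} → ¬ x ≡ y → Linked Q (x ∷ xs) (y ∷ ys) →
               All Q (x ∷ xs) × All Q (y ∷ ys)
    linked-≢ x≢y (diverge qxs qys) = qxs , qys
    linked-≢ x≢x (common _)        = ⊥-elim (x≢x refl)

  -- Following the longest common prefix (found with em) serves every i at once.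
  linked-⋂ : ExcludedMiddle Level.zero → ∀ {xs ys} →
             (∀ i → Linked (P i) xs ys) → Linked (λ x → ∀ i → P i x) xs ys
  linked-⋂ em {[]} h = diverge [] (All-⋂ (linked-[]ˡ ∘ h))
  linked-⋂ em {x ∷ xs} {[]} h = diverge (All-⋂ (linked-[]ˡ ∘ linked-sym ∘ h)) []
  linked-⋂ em {x ∷ xs} {y ∷ ys} h with em {x ≡ y}
  ... | yes refl = common (linked-⋂ em (linked-∷⁻ ∘ h))
  ... | no x≢y   = diverge (All-⋂ (proj₁ ∘ linked-≢ x≢y ∘ h)) (All-⋂ (proj₂ ∘ linked-≢ x≢y ∘ h))

-- Completeness for DForm: a canonical tree model

subformulas strictSubformulas : Fm n → List (Fm n)
subformulas φ = φ ∷ strictSubformulas φ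
strictSubformulas (var p)  = []
strictSubformulas (¬' φ)   = subformulas φ
strictSubformulas (φ ∧' ψ) = subformulas φ ++ subformulas ψ
strictSubformulas (K i φ)  = subformulas φ
strictSubformulas (D G φ)  = subformulas φ
strictSubformulas (R G φ)  = subformulas φ

module Canonical (em : ExcludedMiddle Level.zero) {n : ℕ} (Φ : List (Fm n)) where

  Consistent : Fm n → Set
  Consistent α = ¬ ⊢ ¬' α

  infix 4 _⊩_
  _⊩_ : Fm n → Fm n → Set
  α ⊩ θ = ⊢ (α →' θ)

  ⊩-consistent : ∀ {α θ} → Consistent α → α ⊩ θ → ¬ α ⊩ ¬' θ
  ⊩-consistent c α⊩θ α⊩¬θ = c (refute α⊩θ α⊩¬θ)

  ⊩-∧' : ∀ {α φ ψ} → α ⊩ φ ∧' ψ ⇔ (α ⊩ φ × α ⊩ ψ)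
  ⊩-∧' = mk⇔ (λ p → →'-trans p ∧'-elimˡ , →'-trans p ∧'-elimʳ) (λ (p , q) → →'-∧' p q)

  Decides : Fm n → List (Fm n) → Set
  Decides α Ψ = ∀ {θ} → θ ∈ Ψ → α ⊩ θ ⊎ α ⊩ ¬' θ

  record Atom : Set where
    field
      formula    : Fm n
      consistent : Consistent formula
      decides    : Decides formula Φ
  open Atom

  consistent-split : ∀ {α θ} → Consistent α → Consistent (α ∧' θ) ⊎ Consistent (α ∧' ¬' θ)
  consistent-split {α} {θ} c with em {Consistent (α ∧' θ)}
  ... | yes c₁ = inj₁ c₁
  ... | no ¬c₁ = inj₂ λ ⊢¬₂ → ¬c₁ λ ⊢¬₁ → c (refute-cases ⊢¬₁ ⊢¬₂)

  lindenbaum : ∀ Ψ {α} → Consistent α → ∃[ α′ ] Consistent α′ × α′ ⊩ α × Decides α′ Ψ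
  lindenbaum []      {α} c = α , c , →'-refl , λ ()
  lindenbaum (θ ∷ Ψ) {α} c = Sum.[ step inj₁ , step inj₂ ] (consistent-split c)
    where
      step : ∀ {χ} → (∀ {γ} → γ ⊩ χ → γ ⊩ θ ⊎ γ ⊩ ¬' θ) → Consistent (α ∧' χ) →
             ∃[ α′ ] Consistent α′ × α′ ⊩ α × Decides α′ (θ ∷ Ψ)
      step decide c′ with lindenbaum Ψ c′
      ... | α′ , c″ , α′⊩α∧χ , dec =
        α′ , c″ , proj₁ (to ⊩-∧' α′⊩α∧χ) ,
        λ { (here refl) → decide (proj₂ (to ⊩-∧' α′⊩α∧χ)) ; (there θ∈Ψ) → dec θ∈Ψ }

  extend-to-atom : ∀ {α} → Consistent α → Σ Atom λ a → formula a ⊩ α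
  extend-to-atom c with lindenbaum Φ c
  ... | α′ , c′ , α′⊩α , dec = record { formula = α′ ; consistent = c′ ; decides = dec } , α′⊩α

  D⊆ : Subset n → Fm n → Set
  D⊆ g (D H _) = set H ⊆ˢ g
  D⊆ g _       = ⊥

  D⊆-mono : ∀ {g h} θ → g ⊆ˢ h → D⊆ g θ → D⊆ h θ
  D⊆-mono (D _ _) g⊆h H⊆g = g⊆h ∘ H⊆g

  D⊆-introspective : ∀ G θ → D⊆ (set G) θ → ⊢ (θ →' D G θ) × ⊢ (¬' θ →' D G (¬' θ))
  D⊆-introspective G (D H χ) H⊆G = →'-trans D-4 (D2 H⊆G) , →'-trans 5D (D2 H⊆G)

  infix 4 _≈[_]_
  record _≈[_]_ (a : Atom) (g : Subset n) (b : Atom) : Set where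
    constructor agreeing
    field agree : ∀ {θ} → θ ∈ Φ → D⊆ g θ → formula a ⊩ θ ⇔ formula b ⊩ θ
  open _≈[_]_

  ≈-refl : ∀ {a g} → a ≈[ g ] a
  ≈-refl = agreeing λ _ _ → ⇔-id _

  ≈-sym : ∀ {a b g} → a ≈[ g ] b → b ≈[ g ] a
  ≈-sym a≈b = agreeing λ θ∈Φ d → ⇔-sym (agree a≈b θ∈Φ d)

  ≈-trans : ∀ {a b c g} → a ≈[ g ] b → b ≈[ g ] c → a ≈[ g ] c
  ≈-trans a≈b b≈c = agreeing λ θ∈Φ d → agree b≈c θ∈Φ d ⇔-∘ agree a≈b θ∈Φ d

  ≈-antitone : ∀ {a b g h} → g ⊆ˢ h → a ≈[ h ] b → a ≈[ g ] b
  ≈-antitone g⊆h a≈b = agreeing λ θ∈Φ d → agree a≈b θ∈Φ (D⊆-mono _ g⊆h d)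

  record Shared (G : Grp n) (a : Atom) (Ψ : List (Fm n)) : Set where
    field
      β               : Fm n
      a⊩β             : formula a ⊩ β
      β-introspective : ⊢ (β →' D G β)
      β-decides       : ∀ {θ} → θ ∈ Ψ → D⊆ (set G) θ → β ⊩ θ ⊎ β ⊩ ¬' θ
  open Shared

  shared-∷ : ∀ {G a Ψ θ l} → Shared G a Ψ → formula a ⊩ l → ⊢ (l →' D G l) →
             (∀ {γ} → γ ⊩ l → γ ⊩ θ ⊎ γ ⊩ ¬' θ) → Shared G a (θ ∷ Ψ)
  shared-∷ S a⊩l l-introspective decide = record
    { β               = _ ∧' β S
    ; a⊩β             = →'-∧' a⊩l (a⊩β S)
    ; β-introspective = →'-trans (∧'-mono l-introspective (β-introspective S)) D-∧'
    ; β-decides       = λ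
        { (here refl) _ → decide ∧'-elimˡ
        ; (there θ∈Ψ) d → Sum.map (→'-trans ∧'-elimʳ) (→'-trans ∧'-elimʳ) (β-decides S θ∈Ψ d)
        }
    }

  -- β is the conjunction of the literals that a assigns to the formulas D H χ ∈ Ψ with H ⊆ G.
  shared : ∀ G a Ψ → (∀ {θ} → θ ∈ Ψ → θ ∈ Φ) → Shared G a Ψ
  shared G a [] _ = record
    { β               = var 0 →' var 0
    ; a⊩β             = →'-weaken →'-refl
    ; β-introspective = →'-weaken (D-nec →'-refl)
    ; β-decides       = λ ()
    }
  shared G a (θ ∷ Ψ) Ψ⊆Φ with shared G a Ψ (Ψ⊆Φ ∘ there) | em {D⊆ (set G) θ}
  ... | S | no ¬d = record
    { β               = β S
    ; a⊩β             = a⊩β S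
    ; β-introspective = β-introspective S
    ; β-decides       = λ { (here refl) d → ⊥-elim (¬d d) ; (there θ∈Ψ) → β-decides S θ∈Ψ }
    }
  ... | S | yes d with decides a (Ψ⊆Φ (here refl))
  ...   | inj₁ a⊩θ  = shared-∷ S a⊩θ  (proj₁ (D⊆-introspective G θ d)) inj₁
  ...   | inj₂ a⊩¬θ = shared-∷ S a⊩¬θ (proj₂ (D⊆-introspective G θ d)) inj₂

  shared-≈ : ∀ {G a b} (S : Shared G a Φ) → formula b ⊩ β S → a ≈[ set G ] b
  shared-≈ {G} {a} {b} S b⊩β = agreeing agreement
    where
      agreement : ∀ {θ} → θ ∈ Φ → D⊆ (set G) θ → formula a ⊩ θ ⇔ formula b ⊩ θ
      agreement θ∈Φ d with β-decides S θ∈Φ d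
      ... | inj₁ β⊩θ  = mk⇔ (λ _ → →'-trans b⊩β β⊩θ) (λ _ → →'-trans (a⊩β S) β⊩θ)
      ... | inj₂ β⊩¬θ = mk⇔
        (λ a⊩θ → ⊥-elim (⊩-consistent (consistent a) a⊩θ (→'-trans (a⊩β S) β⊩¬θ)))
        (λ b⊩θ → ⊥-elim (⊩-consistent (consistent b) b⊩θ (→'-trans b⊩β β⊩¬θ)))

  existence : ∀ a G χ → ¬ formula a ⊩ D G χ → Σ Atom λ b → a ≈[ set G ] b × formula b ⊩ ¬' χ
  existence a G χ a⊮Dχ =
    let b , b⊩β∧¬χ = extend-to-atom β∧¬χ-consistent
        b⊩β , b⊩¬χ = to ⊩-∧' b⊩β∧¬χ
    in b , shared-≈ S b⊩β , b⊩¬χ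
    where
      S = shared G a Φ id
      β∧¬χ-consistent : Consistent (β S ∧' ¬' χ)
      β∧¬χ-consistent β⊩χ = a⊮Dχ (→'-trans (a⊩β S) (→'-trans (β-introspective S) (D-mono β⊩χ)))

  Step : Set
  Step = Subset n × Atom

  IsPath : Atom → List Step → Set
  IsPath a []            = ⊤
  IsPath a ((g , b) ∷ π) = a ≈[ g ] b × IsPath b π

  end : Atom → List Step → Atom
  end a []            = a
  end a ((_ , b) ∷ π) = end b π

  isPath-snoc : ∀ {a g b} π → IsPath a π → end a π ≈[ g ] b → IsPath a (π ++ (g , b) ∷ [])
  isPath-snoc []      _         e = e , tt
  isPath-snoc (_ ∷ π) (a≈ , p) e = a≈ , isPath-snoc π p e

  end-snoc : ∀ {a g b} π → end a (π ++ (g , b) ∷ []) ≡ b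
  end-snoc []            = refl
  end-snoc ((_ , c) ∷ π) = end-snoc {c} π

  path-≈ : ∀ {a g} π → IsPath a π → All ((g ⊆ˢ_) ∘ proj₁) π → a ≈[ g ] end a π
  path-≈ []      _         _            = ≈-refl
  path-≈ (_ ∷ π) (a≈b , p) (g⊆h ∷ g⊆π) = ≈-trans (≈-antitone g⊆h a≈b) (path-≈ π p g⊆π)

  linked-≈ : ∀ {a g π π′} → Linked ((g ⊆ˢ_) ∘ proj₁) π π′ → IsPath a π → IsPath a π′ →
             end a π ≈[ g ] end a π′
  linked-≈ (diverge g⊆π g⊆π′) p p′ = ≈-trans (≈-sym (path-≈ _ p g⊆π)) (path-≈ _ p′ g⊆π′)
  linked-≈ (common r) (_ , p) (_ , p′) = linked-≈ r p p′

  module CanonicalModel (root : Atom) where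

    State : Set
    State = Σ (List Step) (IsPath root)

    atomAt : State → Atom
    atomAt (π , _) = end root π

    -- The tree path between the two states crosses only edges whose label contains i.
    ∼ᶜ : Rels n State
    ∼ᶜ i (π , _) (π′ , _) = Linked ((i ∈ˢ_) ∘ proj₁) π π′

    canonical : Model n
    canonical = record
      { S     = State
      ; ∼     = ∼ᶜ
      ; equiv = λ i → record { refl = linked-refl _ ; sym = linked-sym ; trans = linked-trans }
      ; V     = λ p s → formula (atomAt s) ⊩ var p
      }

    ∼G-≈ : ∀ G s t → ∼G ∼ᶜ G s t → atomAt s ≈[ set G ] atomAt t
    ∼G-≈ G (π , p) (π′ , p′) s∼t = linked-≈ (linked-map (λ h i∈G → h (_ , i∈G)) ⋂-linked) p p′
      where
        ⋂-linked = linked-⋂ {P = λ (i , _) step → i ∈ˢ proj₁ step} em λ (i , i∈G) → s∼t i i∈G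

    child : ∀ s G b → atomAt s ≈[ set G ] b → Σ State λ t → ∼G ∼ᶜ G s t × atomAt t ≡ b
    child (π , p) G b s≈b =
      (π ++ (set G , b) ∷ [] , isPath-snoc π p s≈b) , (λ i i∈G → linked-snoc i∈G π) , end-snoc π

    truth : ∀ {θ} → DForm θ → (∀ {χ} → χ ∈ subformulas θ → χ ∈ Φ) →
            ∀ s → canonical , s ⊨ θ ⇔ formula (atomAt s) ⊩ θ
    truth var _ s = ⇔-id _
    truth (¬'_ {φ} d) sub s = mk⇔ forth back
      where
        ih = truth d (sub ∘ there) s
        forth : ¬ canonical , s ⊨ φ → formula (atomAt s) ⊩ ¬' φ
        forth ⊭φ with decides (atomAt s) (sub (there (here refl)))
        ... | inj₁ ⊩φ  = ⊥-elim (⊭φ (from ih ⊩φ))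
        ... | inj₂ ⊩¬φ = ⊩¬φ
        back : formula (atomAt s) ⊩ ¬' φ → ¬ canonical , s ⊨ φ
        back ⊩¬φ ⊨φ = ⊩-consistent (consistent (atomAt s)) (to ih ⊨φ) ⊩¬φ
    truth (_∧'_ {φ} d d′) sub s = ⇔-sym ⊩-∧' ⇔-∘
      (truth d (sub ∘ there ∘ ∈-++⁺ˡ) s ×-⇔ truth d′ (sub ∘ there ∘ ∈-++⁺ʳ (subformulas φ)) s)
    truth (D {G} {φ} d) sub s = mk⇔ forth back
      where
        ih : ∀ t → canonical , t ⊨ φ ⇔ formula (atomAt t) ⊩ φ
        ih = truth d (sub ∘ there)
        forth : (∀ t → ∼G ∼ᶜ G s t → canonical , t ⊨ φ) → formula (atomAt s) ⊩ D G φ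
        forth ⊨□φ = decidable-stable em λ ⊮Dφ →
          let b , s≈b , b⊩¬φ = existence (atomAt s) G φ ⊮Dφ
              t , s∼t , t≡b  = child s G b s≈b
              b⊩φ            = subst (λ c → formula c ⊩ φ) t≡b (to (ih t) (⊨□φ t s∼t))
          in ⊩-consistent (consistent b) b⊩φ b⊩¬φ
        back : formula (atomAt s) ⊩ D G φ → ∀ t → ∼G ∼ᶜ G s t → canonical , t ⊨ φ
        back ⊩Dφ t s∼t = from (ih t) (→'-trans (to (agree (∼G-≈ G s t s∼t) (sub (here refl)) id) ⊩Dφ) TD)

DForm-complete : ExcludedMiddle Level.zero → ∀ {ψ : Fm n} → DForm ψ → Valid ψ → ⊢ ψ
DForm-complete em {ψ = ψ} d ⊨ψ = decidable-stable em λ ⊬ψ →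
  let root , root⊩¬ψ = extend-to-atom (⊬ψ ∘ ¬'¬'-elim)
      open CanonicalModel root
      root⊩ψ = to (truth d id ([] , tt)) (⊨ψ canonical ([] , tt))
  in ⊩-consistent (Atom.consistent root) root⊩ψ root⊩¬ψ
  where open Canonical em (subformulas ψ)

completeness : ExcludedMiddle Level.zero → ∀ {φ : Fm n} → Valid φ → ⊢ φ
completeness em {φ} ⊨φ =
  MP (DForm-complete em (reduce-DForm φ) ⊨reduce-φ) (↔'-from (reduce-equiv φ))
  where ⊨reduce-φ = Soundness.valid-→' em (↔'-to (reduce-equiv φ)) ⊨φ

theorem1 : ExcludedMiddle Level.zero → (n : ℕ) (φ : Fm n) →
    (Valid φ → ⊢ φ) × (⊢ φ → Valid φ)
theorem1 em n φ = completeness em , Soundness.soundness em
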